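{- Let $G$ be a finite abelian group, let $S\subseteq G$ be a nonempty subset, let $g\in G$ and let $i\geq 1$ be an integer. Then \[ M_S(G,i,g)=\sum_{t=1}^{i} (-1)^{t-1} \sum_{\substack{\{u_1,\dots,u_t\}\subseteq S\\ \text{$t$ distinct elements}}} M\bigl(G,\, i-t,\, g-(u_1+\cdots+u_t)\bigr), \] where an inner sum is empty (equal to $0$) when $t>|S|$. Consequently $M(G\setminus S,i,g)=M(G,i,g)-M_S(G,i,g)$.
   Context: For a subset $D$ of $G$, $M(D,i,g)$ denotes the number of multisubsets of $D$ (multisets with elements in $D$, repetitions allowed) of size $i$ (counted with multiplicity) whose elements sum to $g$. Conventions: $M(G,0,0)=1$ and $M(G,0,s)=0$ for $s\neq 0$. $M_S(G,i,g)$ denotes the number of multisubsets of $G$ of size $i$ whose elements sum to $g$ and which contain at least one element of $S$. -}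

module Defs where

open import Data.Bool using (Bool; true; false; _∧_; _∨_; not; if_then_else_)
open import Data.Nat as ℕ using (ℕ; zero; suc; _∸_; _≡ᵇ_)
open import Data.Fin using (Fin)
open import Data.Fin.Subset using (Subset; ∣_∣)
open import Data.Fin.Properties using (_≟_)
open import Data.Vec as Vec using (Vec; []; _∷_; zipWith; allFin; toList)
open import Data.List as List using (List; []; _∷_; [_]; upTo; concatMap; filterᵇ; length)
open import Data.Integer as ℤ using (ℤ)
open import Relation.Nullary using (does)
open import Data.Bool.ListAction using (and; or)
open import Algebra.Core using (Op₁; Op₂)

-- All multiplicity vectors m : Vec ℕ n with m₀ + … + m_{n-1} = i,
-- i.e. all multisubsets of Fin n of size i (each listed exactly once).
multisets : (n i : ℕ) → List (Vec ℕ n)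
multisets zero zero = [ [] ]
multisets zero (suc i) = []
multisets (suc n) i = concatMap (λ k → List.map (k ∷_) (multisets n (i ∸ k))) (upTo (suc i))

allSubsets : (n : ℕ) → List (Subset n)
allSubsets zero = [ [] ]
allSubsets (suc n) = List.map (true ∷_) (allSubsets n) List.++ List.map (false ∷_) (allSubsets n)

-- A finite abelian group G is represented (up to isomorphism) by an
-- abelian group structure (_+_, 0#, -_) on Fin n with equality _≡_.
module Counting {n : ℕ} (_+_ : Op₂ (Fin n)) (0# : Fin n) (-_ : Op₁ (Fin n)) where

  times : ℕ → Fin n → Fin n
  times zero x = 0#
  times (suc k) x = x + times k x

  groupSum : List (Fin n) → Fin n
  groupSum = List.foldr _+_ 0#

  total : Vec ℕ n → Fin n
  total m = groupSum (toList (zipWith times m (allFin n)))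

  subsetSum : Subset n → Fin n
  subsetSum U = groupSum (toList (zipWith (λ b x → if b then x else 0#) U (allFin n)))

  supportedIn : Subset n → Vec ℕ n → Bool
  supportedIn D m = and (toList (zipWith (λ k b → (k ≡ᵇ 0) ∨ b) m D))

  meets : Subset n → Vec ℕ n → Bool
  meets S m = or (toList (zipWith (λ k b → not (k ≡ᵇ 0) ∧ b) m S))

  M : Subset n → ℕ → Fin n → ℕ
  M D i g = length (filterᵇ (λ m → supportedIn D m ∧ does (total m ≟ g)) (multisets n i))

  M-S : Subset n → ℕ → Fin n → ℕ
  M-S S i g = length (filterᵇ (λ m → meets S m ∧ does (total m ≟ g)) (multisets n i))

  subsetsOfSize : Subset n → ℕ → List (Subset n)
  subsetsOfSize S t = filterᵇ (λ U → does (Data.Fin.Subset.Properties._⊆?_ U S) ∧ (∣ U ∣ ≡ᵇ t)) (allSubsets n)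
    where import Data.Fin.Subset.Properties

  sumℤ : List ℤ → ℤ
  sumℤ = List.foldr ℤ._+_ (ℤ.+ 0)

-- For a multiset m, inclusion–exclusion over the elements of S occurring in m gives
-- [m meets S] = Σ_{∅ ≠ U ⊆ S, U ⊆ supp m} (-1)^(|U|-1).  Summing over the multisets of size i
-- with sum g and exchanging the sums, U contributes the number of such multisets containing U;
-- removing one copy of each element of U identifies these with the multisets of size i − |U|
-- with sum g − ΣU.  Grouping the subsets U by size gives the formula.  The second identity holds
-- because a multiset either meets S or is supported in G ∖ S.
module Submission where

open import Defs
open import Data.Nat using (ℕ; suc; _≤_; _∸_)
open import Data.Fin using (Fin)
open import Data.Fin.Subset using (Subset; Nonempty; ⊤; ∁)
open import Data.List using (map; upTo)
open import Data.Integer using (ℤ; +_; -[1+_]; _*_; _^_; _-_)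
open import Data.Product using (_×_)
open import Algebra.Core using (Op₁; Op₂)
open import Algebra.Structures using (IsAbelianGroup)
open import Relation.Binary.PropositionalEquality using (_≡_)

open import Data.Nat using (zero; _<_; _≤ᵇ_; _<ᵇ_; _≡ᵇ_; _≤?_; s≤s; z≤n) renaming (_+_ to _+ℕ_)
import Data.Nat.Properties as ℕ
open import Data.Integer using (0ℤ; 1ℤ; -1ℤ; _+_)
import Data.Integer.Properties as ℤ
open import Data.Integer.Tactic.RingSolver using (solve-∀)
open import Data.Bool using (Bool; true; false; if_then_else_; _∧_; _∨_; not; T)
open import Data.Bool.Properties using (∧-comm)
open import Data.Bool.ListAction using (and; or)
open import Data.List using (List; []; _∷_; _++_; foldr; concatMap; filterᵇ; length; applyUpTo)
open import Data.Vec using (Vec; []; _∷_; zipWith; toList; allFin; replicate)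
import Data.Vec as Vec
open import Data.Fin.Subset using (inside; outside; ∣_∣)
open import Data.Fin.Subset.Properties using (_⊆?_)
open import Data.Fin.Properties using (_≟_)
open import Data.Product using (_,_)
open import Data.Empty using (⊥-elim)
open import Function using (_∘_)
open import Relation.Nullary using (Dec; does; yes; no; ¬_)
open import Relation.Binary.PropositionalEquality
  using (refl; sym; trans; cong; cong₂; subst; module ≡-Reasoning)
open import Algebra.Bundles using (AbelianGroup)
import Algebra.Properties.Group as GroupProperties
import Algebra.Properties.CommutativeSemigroup as CommutativeSemigroupProperties

open ≡-Reasoning

when : Bool → ℤ → ℤ
when true  x = x
when false _ = 0ℤ

when-true : ∀ {b x} → T b → when b x ≡ x
when-true {true} _ = refl

when-false : ∀ {b x} → ¬ T b → when b x ≡ 0ℤ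
when-false {false} _  = refl
when-false {true}  ¬t = ⊥-elim (¬t _)

when-0 : ∀ b → when b 0ℤ ≡ 0ℤ
when-0 true  = refl
when-0 false = refl

when-∧ : ∀ b c x → when (b ∧ c) x ≡ when b (when c x)
when-∧ true  c x = refl
when-∧ false c x = refl

*-when : ∀ x b y → x * when b y ≡ when b (x * y)
*-when x true  y = refl
*-when x false y = ℤ.*-zeroʳ x

∑ : {A : Set} → (A → ℤ) → List A → ℤ
∑ f []       = 0ℤ
∑ f (x ∷ xs) = f x + ∑ f xs

sum-map≡∑ : ∀ {A : Set} (f : A → ℤ) xs → foldr _+_ 0ℤ (map f xs) ≡ ∑ f xs
sum-map≡∑ f []       = refl
sum-map≡∑ f (x ∷ xs) = cong (λ s → f x + s) (sum-map≡∑ f xs)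

module _ {A : Set} where

  ∑-cong : {f g : A → ℤ} → (∀ x → f x ≡ g x) → ∀ xs → ∑ f xs ≡ ∑ g xs
  ∑-cong f≗g []       = refl
  ∑-cong f≗g (x ∷ xs) = cong₂ _+_ (f≗g x) (∑-cong f≗g xs)

  ∑-zero : ∀ xs → ∑ (λ (_ : A) → 0ℤ) xs ≡ 0ℤ
  ∑-zero []       = refl
  ∑-zero (x ∷ xs) = trans (ℤ.+-identityˡ _) (∑-zero xs)

  ∑-++ : ∀ (f : A → ℤ) xs ys → ∑ f (xs ++ ys) ≡ ∑ f xs + ∑ f ys
  ∑-++ f []       ys = sym (ℤ.+-identityˡ _)
  ∑-++ f (x ∷ xs) ys = trans (cong (λ s → f x + s) (∑-++ f xs ys)) (sym (ℤ.+-assoc (f x) _ _))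

  ∑-+ : ∀ (f g : A → ℤ) xs → ∑ (λ x → f x + g x) xs ≡ ∑ f xs + ∑ g xs
  ∑-+ f g []       = refl
  ∑-+ f g (x ∷ xs) = trans (cong (λ s → f x + g x + s) (∑-+ f g xs)) (interchange (f x) (g x) _ _)
    where
    interchange : ∀ a b c d → (a + b) + (c + d) ≡ (a + c) + (b + d)
    interchange = solve-∀

  ∑-difference : ∀ (f g : A → ℤ) xs → ∑ (λ x → f x - g x) xs ≡ ∑ f xs - ∑ g xs
  ∑-difference f g []       = refl
  ∑-difference f g (x ∷ xs) = trans (cong (λ s → f x - g x + s) (∑-difference f g xs)) (interchange (f x) (g x) _ _)
    where
    interchange : ∀ a b c d → (a - b) + (c - d) ≡ (a + c) - (b + d)
    interchange = solve-∀

  ∑-*ˡ : ∀ c (f : A → ℤ) xs → ∑ (λ x → c * f x) xs ≡ c * ∑ f xs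
  ∑-*ˡ c f []       = sym (ℤ.*-zeroʳ c)
  ∑-*ˡ c f (x ∷ xs) = trans (cong (λ s → c * f x + s) (∑-*ˡ c f xs)) (sym (ℤ.*-distribˡ-+ c (f x) _))

  ∑-*ʳ : ∀ c (f : A → ℤ) xs → ∑ (λ x → f x * c) xs ≡ ∑ f xs * c
  ∑-*ʳ c f []       = refl
  ∑-*ʳ c f (x ∷ xs) = trans (cong (λ s → f x * c + s) (∑-*ʳ c f xs)) (sym (ℤ.*-distribʳ-+ c (f x) _))

  ∑-filterᵇ : ∀ (p : A → Bool) (f : A → ℤ) xs → ∑ f (filterᵇ p xs) ≡ ∑ (λ x → when (p x) (f x)) xs
  ∑-filterᵇ p f []       = refl
  ∑-filterᵇ p f (x ∷ xs) with p x
  ... | true  = cong (λ s → f x + s) (∑-filterᵇ p f xs)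
  ... | false = trans (∑-filterᵇ p f xs) (sym (ℤ.+-identityˡ _))

  length-filterᵇ : ∀ (p : A → Bool) xs → + length (filterᵇ p xs) ≡ ∑ (λ x → when (p x) 1ℤ) xs
  length-filterᵇ p []       = refl
  length-filterᵇ p (x ∷ xs) with p x
  ... | true  = cong (λ s → 1ℤ + s) (length-filterᵇ p xs)
  ... | false = trans (length-filterᵇ p xs) (sym (ℤ.+-identityˡ _))

module _ {A B : Set} where

  ∑-map : ∀ (f : B → ℤ) (g : A → B) xs → ∑ f (map g xs) ≡ ∑ (f ∘ g) xs
  ∑-map f g []       = refl
  ∑-map f g (x ∷ xs) = cong (λ s → f (g x) + s) (∑-map f g xs)

  ∑-concatMap : ∀ (f : B → ℤ) (g : A → List B) xs → ∑ f (concatMap g xs) ≡ ∑ (λ x → ∑ f (g x)) xs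
  ∑-concatMap f g []       = refl
  ∑-concatMap f g (x ∷ xs) = trans (∑-++ f (g x) (concatMap g xs)) (cong (λ s → ∑ f (g x) + s) (∑-concatMap f g xs))

  ∑-comm : ∀ (f : A → B → ℤ) xs ys → ∑ (λ x → ∑ (f x) ys) xs ≡ ∑ (λ y → ∑ (λ x → f x y) xs) ys
  ∑-comm f []       ys = sym (∑-zero ys)
  ∑-comm f (x ∷ xs) ys = trans (cong (λ s → ∑ (f x) ys + s) (∑-comm f xs ys)) (sym (∑-+ (f x) _ ys))

∑< : (ℕ → ℤ) → ℕ → ℤ
∑< φ zero    = 0ℤ
∑< φ (suc n) = φ 0 + ∑< (φ ∘ suc) n

∑-applyUpTo : ∀ (φ : ℕ → ℤ) (f : ℕ → ℕ) n → ∑ φ (applyUpTo f n) ≡ ∑< (φ ∘ f) n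
∑-applyUpTo φ f zero    = refl
∑-applyUpTo φ f (suc n) = cong (λ s → φ (f 0) + s) (∑-applyUpTo φ (f ∘ suc) n)

∑<-cong : ∀ {φ ψ : ℕ → ℤ} n → (∀ a → a < n → φ a ≡ ψ a) → ∑< φ n ≡ ∑< ψ n
∑<-cong zero    φ≗ψ = refl
∑<-cong (suc n) φ≗ψ = cong₂ _+_ (φ≗ψ 0 (s≤s z≤n)) (∑<-cong n (λ a a<n → φ≗ψ (suc a) (s≤s a<n)))

∑<-zero : ∀ {φ : ℕ → ℤ} n → (∀ a → a < n → φ a ≡ 0ℤ) → ∑< φ n ≡ 0ℤ
∑<-zero zero    φ≗0 = refl
∑<-zero (suc n) φ≗0 = cong₂ _+_ (φ≗0 0 (s≤s z≤n)) (∑<-zero n (λ a a<n → φ≗0 (suc a) (s≤s a<n)))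

∑<-extend : ∀ {φ : ℕ → ℤ} m n → m ≤ n → (∀ a → m ≤ a → a < n → φ a ≡ 0ℤ) → ∑< φ n ≡ ∑< φ m
∑<-extend zero    n       _         φ≗0 = ∑<-zero n (λ a → φ≗0 a z≤n)
∑<-extend {φ} (suc m) (suc n) (s≤s m≤n) φ≗0 =
  cong (λ s → φ 0 + s) (∑<-extend m n m≤n (λ a m≤a a<n → φ≗0 (suc a) (s≤s m≤a) (s≤s a<n)))

∑<-when-≡ᵇ : ∀ u i (ψ : ℕ → ℤ) → ∑< (λ t → when (u ≡ᵇ t) (ψ t)) i ≡ when (u <ᵇ i) (ψ u)
∑<-when-≡ᵇ u       zero    ψ = refl
∑<-when-≡ᵇ zero    (suc i) ψ = trans (cong (λ s → ψ 0 + s) (∑<-zero i (λ _ _ → refl))) (ℤ.+-identityʳ _)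
∑<-when-≡ᵇ (suc u) (suc i) ψ = trans (ℤ.+-identityˡ _) (∑<-when-≡ᵇ u i (ψ ∘ suc))

≤∸-swap : ∀ {u a i} → a ≤ i → u ≤ i ∸ a → a ≤ i ∸ u
≤∸-swap {u} {a} {i} a≤i u≤i∸a =
  ℕ.m+n≤o⇒m≤o∸n a (subst (_≤ i) (ℕ.+-comm u a) (ℕ.m≤o∸n⇒m+n≤o u a≤i u≤i∸a))

∸-∸-comm : ∀ i a u → i ∸ a ∸ u ≡ i ∸ u ∸ a
∸-∸-comm i a u = begin
  i ∸ a ∸ u     ≡⟨ ℕ.∸-+-assoc i a u ⟩
  i ∸ (a +ℕ u)  ≡⟨ cong (i ∸_) (ℕ.+-comm a u) ⟩
  i ∸ (u +ℕ a)  ≡⟨ ℕ.∸-+-assoc i u a ⟨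
  i ∸ u ∸ a     ∎

∑<-truncate : ∀ u i (G : ℕ → ℕ → ℤ) →
  ∑< (λ a → when (u ≤ᵇ i ∸ a) (G a (i ∸ a ∸ u))) (suc i)
  ≡ when (u ≤ᵇ i) (∑< (λ a → G a (i ∸ u ∸ a)) (suc (i ∸ u)))
∑<-truncate u i G = byCases (u ≤? i)
  where
  φ : ℕ → ℤ
  φ a = when (u ≤ᵇ i ∸ a) (G a (i ∸ a ∸ u))
  byCases : Dec (u ≤ i) → ∑< φ (suc i) ≡ when (u ≤ᵇ i) (∑< (λ a → G a (i ∸ u ∸ a)) (suc (i ∸ u)))
  byCases (no u≰i) = trans (∑<-zero {φ} (suc i) (λ a _ → when-false (u≰i ∘ u≤i∸a⇒u≤i a)))
                           (sym (when-false (u≰i ∘ ℕ.≤ᵇ⇒≤ u i)))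
    where
    u≤i∸a⇒u≤i : ∀ a → T (u ≤ᵇ i ∸ a) → u ≤ i
    u≤i∸a⇒u≤i a t = ℕ.≤-trans (ℕ.≤ᵇ⇒≤ u (i ∸ a) t) (ℕ.m∸n≤m i a)
  byCases (yes u≤i) = begin
    ∑< φ (suc i)
      ≡⟨ ∑<-extend (suc (i ∸ u)) (suc i) (s≤s (ℕ.m∸n≤m i u)) vanish ⟩
    ∑< φ (suc (i ∸ u))
      ≡⟨ ∑<-cong (suc (i ∸ u)) agree ⟩
    ∑< (λ a → G a (i ∸ u ∸ a)) (suc (i ∸ u))
      ≡⟨ when-true (ℕ.≤⇒≤ᵇ u≤i) ⟨
    when (u ≤ᵇ i) (∑< (λ a → G a (i ∸ u ∸ a)) (suc (i ∸ u))) ∎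
    where
    vanish : ∀ a → suc (i ∸ u) ≤ a → a < suc i → φ a ≡ 0ℤ
    vanish a i∸u<a (s≤s a≤i) =
      when-false (λ t → ℕ.<⇒≱ i∸u<a (≤∸-swap a≤i (ℕ.≤ᵇ⇒≤ u (i ∸ a) t)))
    agree : ∀ a → a < suc (i ∸ u) → φ a ≡ G a (i ∸ u ∸ a)
    agree a (s≤s a≤i∸u) = trans (when-true (ℕ.≤⇒≤ᵇ (≤∸-swap u≤i a≤i∸u))) (cong (G a) (∸-∸-comm i a u))

∑-multisets-suc : ∀ k i (F : Vec ℕ (suc k) → ℤ) →
  ∑ F (multisets (suc k) i) ≡ ∑< (λ a → ∑ (λ m → F (a ∷ m)) (multisets k (i ∸ a))) (suc i)
∑-multisets-suc k i F = begin
  ∑ F (concatMap (λ a → map (a ∷_) (multisets k (i ∸ a))) (upTo (suc i)))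
    ≡⟨ ∑-concatMap F (λ a → map (a ∷_) (multisets k (i ∸ a))) (upTo (suc i)) ⟩
  ∑ (λ a → ∑ F (map (a ∷_) (multisets k (i ∸ a)))) (upTo (suc i))
    ≡⟨ ∑-cong (λ a → ∑-map F (a ∷_) (multisets k (i ∸ a))) (upTo (suc i)) ⟩
  ∑ (λ a → ∑ (λ m → F (a ∷ m)) (multisets k (i ∸ a))) (upTo (suc i))
    ≡⟨ ∑-applyUpTo (λ a → ∑ (λ m → F (a ∷ m)) (multisets k (i ∸ a))) (λ a → a) (suc i) ⟩
  ∑< (λ a → ∑ (λ m → F (a ∷ m)) (multisets k (i ∸ a))) (suc i) ∎

∑-allSubsets-suc : ∀ k (F : Subset (suc k) → ℤ) →
  ∑ F (allSubsets (suc k)) ≡ ∑ (λ U → F (inside ∷ U)) (allSubsets k) + ∑ (λ U → F (outside ∷ U)) (allSubsets k)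
∑-allSubsets-suc k F = trans (∑-++ F (map (inside ∷_) (allSubsets k)) (map (outside ∷_) (allSubsets k)))
  (cong₂ _+_ (∑-map F (inside ∷_) (allSubsets k)) (∑-map F (outside ∷_) (allSubsets k)))

commonSubsetSum : ∀ {k} → (ℕ → ℤ) → Subset k → Subset k → ℤ
commonSubsetSum {k} c S T = ∑ (λ U → when (does (U ⊆? S)) (when (does (U ⊆? T)) (c ∣ U ∣))) (allSubsets k)

commonSubsetSum-∷ : ∀ {k} (c : ℕ → ℤ) s t (S T : Subset k) →
  commonSubsetSum c (s ∷ S) (t ∷ T) ≡ when (s ∧ t) (commonSubsetSum (c ∘ suc) S T) + commonSubsetSum c S T
commonSubsetSum-∷ {k} c s t S T =
  trans (∑-allSubsets-suc k _) (cong (λ x → x + commonSubsetSum c S T) (withInside s t))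
  where
  withInside : ∀ s t →
    ∑ (λ U → when (does (inside ∷ U ⊆? s ∷ S)) (when (does (inside ∷ U ⊆? t ∷ T)) (c (suc ∣ U ∣)))) (allSubsets k)
    ≡ when (s ∧ t) (commonSubsetSum (c ∘ suc) S T)
  withInside false t    = ∑-zero (allSubsets k)
  withInside true false = trans (∑-cong (λ U → when-0 (does (U ⊆? S))) (allSubsets k)) (∑-zero (allSubsets k))
  withInside true true  = refl

commonSubsetSum-*ˡ : ∀ {k} x (c : ℕ → ℤ) (S T : Subset k) →
  commonSubsetSum (λ u → x * c u) S T ≡ x * commonSubsetSum c S T
commonSubsetSum-*ˡ {k} x c S T = trans (∑-cong pull (allSubsets k)) (∑-*ˡ x _ (allSubsets k))
  where
  pull : ∀ U → when (does (U ⊆? S)) (when (does (U ⊆? T)) (x * c ∣ U ∣))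
             ≡ x * when (does (U ⊆? S)) (when (does (U ⊆? T)) (c ∣ U ∣))
  pull U = sym (trans (*-when x (does (U ⊆? S)) _) (cong (when (does (U ⊆? S))) (*-when x (does (U ⊆? T)) _)))

intersects : ∀ {k} → Subset k → Subset k → Bool
intersects []      []      = false
intersects (s ∷ S) (t ∷ T) = (s ∧ t) ∨ intersects S T

commonSubsetSum-alternating : ∀ {k} (S T : Subset k) → commonSubsetSum (-1ℤ ^_) S T ≡ when (not (intersects S T)) 1ℤ
commonSubsetSum-alternating []      []      = refl
commonSubsetSum-alternating (s ∷ S) (t ∷ T) = begin
  commonSubsetSum (-1ℤ ^_) (s ∷ S) (t ∷ T)
    ≡⟨ commonSubsetSum-∷ (-1ℤ ^_) s t S T ⟩
  when (s ∧ t) (commonSubsetSum (λ u → -1ℤ * -1ℤ ^ u) S T) + commonSubsetSum (-1ℤ ^_) S T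
    ≡⟨ cong (λ x → when (s ∧ t) x + commonSubsetSum (-1ℤ ^_) S T) (commonSubsetSum-*ˡ -1ℤ (-1ℤ ^_) S T) ⟩
  when (s ∧ t) (-1ℤ * commonSubsetSum (-1ℤ ^_) S T) + commonSubsetSum (-1ℤ ^_) S T
    ≡⟨ cong (λ x → when (s ∧ t) (-1ℤ * x) + x) (commonSubsetSum-alternating S T) ⟩
  when (s ∧ t) (-1ℤ * A) + A
    ≡⟨ cancel (s ∧ t) ⟩
  when (not ((s ∧ t) ∨ intersects S T)) 1ℤ ∎
  where
  A : ℤ
  A = when (not (intersects S T)) 1ℤ
  cancel : ∀ b → when b (-1ℤ * A) + A ≡ when (not (b ∨ intersects S T)) 1ℤ
  cancel true  = trans (cong (_+ A) (ℤ.-1*i≡-i A)) (ℤ.+-inverseˡ A)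
  cancel false = ℤ.+-identityˡ A

-- Unlike (-1)^(t ∸ 1), this gives the empty set weight 0, so sums may range over all subsets.
ieCoeff : ℕ → ℤ
ieCoeff zero    = 0ℤ
ieCoeff (suc t) = -1ℤ ^ t

inclusion-exclusion : ∀ {k} (S T : Subset k) → commonSubsetSum ieCoeff S T ≡ when (intersects S T) 1ℤ
inclusion-exclusion []      []      = refl
inclusion-exclusion (s ∷ S) (t ∷ T) = begin
  commonSubsetSum ieCoeff (s ∷ S) (t ∷ T)
    ≡⟨ commonSubsetSum-∷ ieCoeff s t S T ⟩
  when (s ∧ t) (commonSubsetSum (-1ℤ ^_) S T) + commonSubsetSum ieCoeff S T
    ≡⟨ cong₂ (λ x y → when (s ∧ t) x + y) (commonSubsetSum-alternating S T) (inclusion-exclusion S T) ⟩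
  when (s ∧ t) (when (not (intersects S T)) 1ℤ) + when (intersects S T) 1ℤ
    ≡⟨ combine (s ∧ t) (intersects S T) ⟩
  when ((s ∧ t) ∨ intersects S T) 1ℤ ∎
  where
  combine : ∀ b c → when b (when (not c) 1ℤ) + when c 1ℤ ≡ when (b ∨ c) 1ℤ
  combine true  true  = refl
  combine true  false = refl
  combine false c     = ℤ.+-identityˡ _

when-intersects : ∀ {k} (S T : Subset k) x →
  when (intersects S T) x ≡ ∑ (λ U → when (does (U ⊆? S)) (ieCoeff ∣ U ∣) * when (does (U ⊆? T)) x) (allSubsets k)
when-intersects {k} S T x = sym (begin
  ∑ (λ U → when (does (U ⊆? S)) (ieCoeff ∣ U ∣) * when (does (U ⊆? T)) x) (allSubsets k)
    ≡⟨ ∑-cong (λ U → regroup (does (U ⊆? S)) (does (U ⊆? T)) (ieCoeff ∣ U ∣)) (allSubsets k) ⟩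
  ∑ (λ U → when (does (U ⊆? S)) (when (does (U ⊆? T)) (ieCoeff ∣ U ∣)) * x) (allSubsets k)
    ≡⟨ ∑-*ʳ x _ (allSubsets k) ⟩
  commonSubsetSum ieCoeff S T * x
    ≡⟨ cong (_* x) (inclusion-exclusion S T) ⟩
  when (intersects S T) 1ℤ * x
    ≡⟨ when-1* (intersects S T) ⟩
  when (intersects S T) x ∎)
  where
  regroup : ∀ b d c → when b c * when d x ≡ when b (when d c) * x
  regroup true  true  c = refl
  regroup true  false c = ℤ.*-zeroʳ c
  regroup false d     c = refl
  when-1* : ∀ b → when b 1ℤ * x ≡ when b x
  when-1* true  = ℤ.*-identityˡ x
  when-1* false = refl

∑<-select-size : ∀ p u i (N : ℕ → ℤ) →
  ∑< (λ t → -1ℤ ^ t * when (p ∧ (u ≡ᵇ suc t)) (N (suc t))) i ≡ when p (ieCoeff u) * when (u ≤ᵇ i) (N u)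
∑<-select-size false u       i N = ∑<-zero i (λ t _ → ℤ.*-zeroʳ (-1ℤ ^ t))
∑<-select-size true  zero    i N = ∑<-zero i (λ t _ → ℤ.*-zeroʳ (-1ℤ ^ t))
∑<-select-size true  (suc u) i N = begin
  ∑< (λ t → -1ℤ ^ t * when (u ≡ᵇ t) (N (suc t))) i
    ≡⟨ ∑<-cong i (λ t _ → *-when (-1ℤ ^ t) (u ≡ᵇ t) (N (suc t))) ⟩
  ∑< (λ t → when (u ≡ᵇ t) (-1ℤ ^ t * N (suc t))) i
    ≡⟨ ∑<-when-≡ᵇ u i (λ t → -1ℤ ^ t * N (suc t)) ⟩
  when (u <ᵇ i) (-1ℤ ^ u * N (suc u))
    ≡⟨ *-when (-1ℤ ^ u) (u <ᵇ i) (N (suc u)) ⟨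
  -1ℤ ^ u * when (u <ᵇ i) (N (suc u)) ∎

support : ∀ {k} → Vec ℕ k → Subset k
support = Vec.map (λ a → not (a ≡ᵇ 0))

_+ˢ_ : ∀ {k} → Vec ℕ k → Subset k → Vec ℕ k
[]      +ˢ []            = []
(a ∷ m) +ˢ (outside ∷ U) = a ∷ (m +ˢ U)
(a ∷ m) +ˢ (inside  ∷ U) = suc a ∷ (m +ˢ U)

sucHead : ∀ {k} → Vec ℕ (suc k) → Vec ℕ (suc k)
sucHead (a ∷ m) = suc a ∷ m

<ᵇ-suc : ∀ u i → (u <ᵇ suc i) ≡ (u ≤ᵇ i)
<ᵇ-suc zero    i = refl
<ᵇ-suc (suc u) i = refl

-- Removing one copy of each element of U is a bijection from the multisets of size i containing U
-- onto all multisets of size i − ∣U∣; its inverse is _+ˢ U.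
∑-multisets-⊇ : ∀ {k} (U : Subset k) i (F : Vec ℕ k → ℤ) →
  ∑ (λ m → when (does (U ⊆? support m)) (F m)) (multisets k i)
  ≡ when (∣ U ∣ ≤ᵇ i) (∑ (λ m → F (m +ˢ U)) (multisets k (i ∸ ∣ U ∣)))
∑-multisets-⊇ []            zero    F = refl
∑-multisets-⊇ []            (suc i) F = refl
∑-multisets-⊇ {suc k} (outside ∷ U) i F = begin
  ∑ (λ m → when (does (outside ∷ U ⊆? support m)) (F m)) (multisets (suc k) i)
    ≡⟨ ∑-multisets-suc k i _ ⟩
  ∑< (λ a → ∑ (λ m → when (does (U ⊆? support m)) (F (a ∷ m))) (multisets k (i ∸ a))) (suc i)
    ≡⟨ ∑<-cong (suc i) (λ a _ → ∑-multisets-⊇ U (i ∸ a) (F ∘ (a ∷_))) ⟩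
  ∑< (λ a → when (u ≤ᵇ i ∸ a) (G a (i ∸ a ∸ u))) (suc i)
    ≡⟨ ∑<-truncate u i G ⟩
  when (u ≤ᵇ i) (∑< (λ a → G a (i ∸ u ∸ a)) (suc (i ∸ u)))
    ≡⟨ cong (when (u ≤ᵇ i)) (∑-multisets-suc k (i ∸ u) (λ m → F (m +ˢ (outside ∷ U)))) ⟨
  when (u ≤ᵇ i) (∑ (λ m → F (m +ˢ (outside ∷ U))) (multisets (suc k) (i ∸ u))) ∎
  where
  u : ℕ
  u = ∣ U ∣
  G : ℕ → ℕ → ℤ
  G a j = ∑ (λ m → F (a ∷ (m +ˢ U))) (multisets k j)
∑-multisets-⊇ {suc k} (inside ∷ U) zero F =
  trans (∑-multisets-suc k 0 _) (cong (_+ 0ℤ) (∑-zero (multisets k 0)))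
∑-multisets-⊇ {suc k} (inside ∷ U) (suc i) F = begin
  ∑ (λ m → when (does (inside ∷ U ⊆? support m)) (F m)) (multisets (suc k) (suc i))
    ≡⟨ ∑-multisets-suc k (suc i) _ ⟩
  ∑ (λ _ → 0ℤ) (multisets k (suc i)) + ∑< headPositive (suc i)
    ≡⟨ cong (_+ ∑< headPositive (suc i)) (∑-zero (multisets k (suc i))) ⟩
  0ℤ + ∑< headPositive (suc i)
    ≡⟨ ℤ.+-identityˡ _ ⟩
  ∑< headPositive (suc i)
    ≡⟨ ∑-multisets-suc k i _ ⟨
  ∑ (λ m → when (does (outside ∷ U ⊆? support m)) (F (sucHead m))) (multisets (suc k) i)
    ≡⟨ ∑-multisets-⊇ (outside ∷ U) i (F ∘ sucHead) ⟩
  when (∣ U ∣ ≤ᵇ i) (∑ (λ m → F (sucHead (m +ˢ (outside ∷ U)))) (multisets (suc k) (i ∸ ∣ U ∣)))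
    ≡⟨ cong₂ when (<ᵇ-suc ∣ U ∣ i) (∑-cong (λ { (a ∷ m) → refl }) (multisets (suc k) (i ∸ ∣ U ∣))) ⟨
  when (suc ∣ U ∣ ≤ᵇ suc i) (∑ (λ m → F (m +ˢ (inside ∷ U))) (multisets (suc k) (i ∸ ∣ U ∣))) ∎
  where
  headPositive : ℕ → ℤ
  headPositive a = ∑ (λ m → when (does (U ⊆? support m)) (F (suc a ∷ m))) (multisets k (i ∸ a))

-- The left-hand sides below are meets, supportedIn ⊤ and supportedIn (∁ S) of Counting, at any length.
meets≡intersects-support : ∀ {k} (S : Subset k) (m : Vec ℕ k) →
  or (toList (zipWith (λ a b → not (a ≡ᵇ 0) ∧ b) m S)) ≡ intersects S (support m)
meets≡intersects-support []      []      = refl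
meets≡intersects-support (s ∷ S) (a ∷ m) = cong₂ _∨_ (∧-comm (not (a ≡ᵇ 0)) s) (meets≡intersects-support S m)

supportedIn-⊤ : ∀ {k} (m : Vec ℕ k) → and (toList (zipWith (λ a b → (a ≡ᵇ 0) ∨ b) m (replicate k true))) ≡ true
supportedIn-⊤ []          = refl
supportedIn-⊤ (zero  ∷ m) = supportedIn-⊤ m
supportedIn-⊤ (suc a ∷ m) = supportedIn-⊤ m

supportedIn-∁ : ∀ {k} (S : Subset k) (m : Vec ℕ k) →
  and (toList (zipWith (λ a b → (a ≡ᵇ 0) ∨ b) m (Vec.map not S))) ≡ not (intersects S (support m))
supportedIn-∁ []          []          = refl
supportedIn-∁ (true  ∷ S) (zero  ∷ m) = supportedIn-∁ S m
supportedIn-∁ (true  ∷ S) (suc a ∷ m) = refl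
supportedIn-∁ (false ∷ S) (zero  ∷ m) = supportedIn-∁ S m
supportedIn-∁ (false ∷ S) (suc a ∷ m) = supportedIn-∁ S m

module AbelianCounting {n : ℕ} (_⊕_ : Op₂ (Fin n)) (0# : Fin n) (⊖_ : Op₁ (Fin n))
         (isAbelianGroup : IsAbelianGroup _≡_ _⊕_ 0# ⊖_) where

  open Counting _⊕_ 0# ⊖_

  private
    abelianGroup : AbelianGroup _ _
    abelianGroup = record { isAbelianGroup = isAbelianGroup }

  open AbelianGroup abelianGroup using (assoc; identityˡ; comm; group; commutativeSemigroup)
  open GroupProperties group using (x≈z//y; //-rightDividesˡ)
  open CommutativeSemigroupProperties commutativeSemigroup using (interchange)

  -- total and subsetSum are weightedSum and selectedSum at allFin n; any length k allows induction.
  weightedSum : ∀ {k} → Vec (Fin n) k → Vec ℕ k → Fin n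
  weightedSum xs m = groupSum (toList (zipWith times m xs))

  selectedSum : ∀ {k} → Vec (Fin n) k → Subset k → Fin n
  selectedSum xs U = groupSum (toList (zipWith (λ b x → if b then x else 0#) U xs))

  weightedSum-+ˢ : ∀ {k} (xs : Vec (Fin n) k) m U → weightedSum xs (m +ˢ U) ≡ weightedSum xs m ⊕ selectedSum xs U
  weightedSum-+ˢ []       []      []            = sym (identityˡ 0#)
  weightedSum-+ˢ (x ∷ xs) (a ∷ m) (outside ∷ U) = begin
    times a x ⊕ weightedSum xs (m +ˢ U)                      ≡⟨ cong (times a x ⊕_) (weightedSum-+ˢ xs m U) ⟩
    times a x ⊕ (weightedSum xs m ⊕ selectedSum xs U)        ≡⟨ assoc _ _ _ ⟨
    (times a x ⊕ weightedSum xs m) ⊕ selectedSum xs U        ≡⟨ cong ((times a x ⊕ weightedSum xs m) ⊕_) (identityˡ _) ⟨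
    (times a x ⊕ weightedSum xs m) ⊕ (0# ⊕ selectedSum xs U) ∎
  weightedSum-+ˢ (x ∷ xs) (a ∷ m) (inside ∷ U) = begin
    (x ⊕ times a x) ⊕ weightedSum xs (m +ˢ U)               ≡⟨ cong ((x ⊕ times a x) ⊕_) (weightedSum-+ˢ xs m U) ⟩
    (x ⊕ times a x) ⊕ (weightedSum xs m ⊕ selectedSum xs U) ≡⟨ cong (_⊕ (weightedSum xs m ⊕ selectedSum xs U)) (comm x (times a x)) ⟩
    (times a x ⊕ x) ⊕ (weightedSum xs m ⊕ selectedSum xs U) ≡⟨ interchange _ _ _ _ ⟩
    (times a x ⊕ weightedSum xs m) ⊕ (x ⊕ selectedSum xs U) ∎

  does-⊕-≟ : ∀ a s g → does (a ⊕ s ≟ g) ≡ does (a ≟ g ⊕ (⊖ s))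
  does-⊕-≟ a s g with a ⊕ s ≟ g | a ≟ g ⊕ (⊖ s)
  ... | yes _   | yes _   = refl
  ... | no  _   | no  _   = refl
  ... | yes a+s≡g | no a≢g-s = ⊥-elim (a≢g-s (x≈z//y a s g a+s≡g))
  ... | no a+s≢g  | yes a≡g-s = ⊥-elim (a+s≢g (trans (cong (_⊕ s) a≡g-s) (//-rightDividesˡ s g)))

  sumsTo : Fin n → Vec ℕ n → ℤ
  sumsTo g m = when (does (total m ≟ g)) 1ℤ

  M-⊤≡∑ : ∀ i g → + M ⊤ i g ≡ ∑ (sumsTo g) (multisets n i)
  M-⊤≡∑ i g = trans (length-filterᵇ _ (multisets n i))
    (∑-cong (λ m → cong (λ b → when (b ∧ does (total m ≟ g)) 1ℤ) (supportedIn-⊤ m)) (multisets n i))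

  M-S≡∑ : ∀ S i g → + M-S S i g ≡ ∑ (λ m → when (intersects S (support m)) (sumsTo g m)) (multisets n i)
  M-S≡∑ S i g = trans (length-filterᵇ _ (multisets n i)) (∑-cong split (multisets n i))
    where
    split : ∀ m → when (meets S m ∧ does (total m ≟ g)) 1ℤ ≡ when (intersects S (support m)) (sumsTo g m)
    split m = trans (when-∧ (meets S m) _ 1ℤ) (cong (λ b → when b (sumsTo g m)) (meets≡intersects-support S m))

  M-∁≡∑ : ∀ S i g → + M (∁ S) i g ≡ ∑ (λ m → when (not (intersects S (support m))) (sumsTo g m)) (multisets n i)
  M-∁≡∑ S i g = trans (length-filterᵇ _ (multisets n i)) (∑-cong split (multisets n i))
    where
    split : ∀ m → when (supportedIn (∁ S) m ∧ does (total m ≟ g)) 1ℤ ≡ when (not (intersects S (support m))) (sumsTo g m)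
    split m = trans (when-∧ (supportedIn (∁ S) m) _ 1ℤ) (cong (λ b → when b (sumsTo g m)) (supportedIn-∁ S m))

  ∑-sumsTo-⊇ : ∀ U i g → ∑ (λ m → when (does (U ⊆? support m)) (sumsTo g m)) (multisets n i)
                       ≡ when (∣ U ∣ ≤ᵇ i) (+ M ⊤ (i ∸ ∣ U ∣) (g ⊕ (⊖ subsetSum U)))
  ∑-sumsTo-⊇ U i g = begin
    ∑ (λ m → when (does (U ⊆? support m)) (sumsTo g m)) (multisets n i)
      ≡⟨ ∑-multisets-⊇ U i (sumsTo g) ⟩
    when (∣ U ∣ ≤ᵇ i) (∑ (λ m → sumsTo g (m +ˢ U)) (multisets n (i ∸ ∣ U ∣)))
      ≡⟨ cong (when (∣ U ∣ ≤ᵇ i)) (∑-cong shifted (multisets n (i ∸ ∣ U ∣))) ⟩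
    when (∣ U ∣ ≤ᵇ i) (∑ (sumsTo (g ⊕ (⊖ subsetSum U))) (multisets n (i ∸ ∣ U ∣)))
      ≡⟨ cong (when (∣ U ∣ ≤ᵇ i)) (M-⊤≡∑ (i ∸ ∣ U ∣) (g ⊕ (⊖ subsetSum U))) ⟨
    when (∣ U ∣ ≤ᵇ i) (+ M ⊤ (i ∸ ∣ U ∣) (g ⊕ (⊖ subsetSum U))) ∎
    where
    shifted : ∀ m → sumsTo g (m +ˢ U) ≡ sumsTo (g ⊕ (⊖ subsetSum U)) m
    shifted m = cong (λ b → when b 1ℤ) (trans (cong (λ x → does (x ≟ g)) (weightedSum-+ˢ (allFin n) m U))
                                               (does-⊕-≟ (total m) (subsetSum U) g))

  signedCount : Subset n → ℕ → Fin n → Subset n → ℤ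
  signedCount S i g U = when (does (U ⊆? S)) (ieCoeff ∣ U ∣) * when (∣ U ∣ ≤ᵇ i) (+ M ⊤ (i ∸ ∣ U ∣) (g ⊕ (⊖ subsetSum U)))

  M-S≡∑-signedCount : ∀ S i g → + M-S S i g ≡ ∑ (signedCount S i g) (allSubsets n)
  M-S≡∑-signedCount S i g = begin
    + M-S S i g
      ≡⟨ M-S≡∑ S i g ⟩
    ∑ (λ m → when (intersects S (support m)) (sumsTo g m)) ms
      ≡⟨ ∑-cong (λ m → when-intersects S (support m) (sumsTo g m)) ms ⟩
    ∑ (λ m → ∑ (λ U → c U * when (does (U ⊆? support m)) (sumsTo g m)) subsets) ms
      ≡⟨ ∑-comm (λ m U → c U * when (does (U ⊆? support m)) (sumsTo g m)) ms subsets ⟩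
    ∑ (λ U → ∑ (λ m → c U * when (does (U ⊆? support m)) (sumsTo g m)) ms) subsets
      ≡⟨ ∑-cong (λ U → ∑-*ˡ (c U) _ ms) subsets ⟩
    ∑ (λ U → c U * ∑ (λ m → when (does (U ⊆? support m)) (sumsTo g m)) ms) subsets
      ≡⟨ ∑-cong (λ U → cong (c U *_) (∑-sumsTo-⊇ U i g)) subsets ⟩
    ∑ (signedCount S i g) subsets ∎
    where
    ms : List (Vec ℕ n)
    ms = multisets n i
    subsets : List (Subset n)
    subsets = allSubsets n
    c : Subset n → ℤ
    c U = when (does (U ⊆? S)) (ieCoeff ∣ U ∣)

  ∑-bySize≡∑-signedCount : ∀ S i g →
    sumℤ (map (λ t → (-[1+ 0 ] ^ (t ∸ 1)) * sumℤ (map (λ U → + M ⊤ (i ∸ t) (g ⊕ (⊖ subsetSum U))) (subsetsOfSize S t))) (map suc (upTo i)))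
    ≡ ∑ (signedCount S i g) (allSubsets n)
  ∑-bySize≡∑-signedCount S i g = begin
    sumℤ (map (λ t → sign t * sumℤ (map (N t) (subsetsOfSize S t))) sizes)
      ≡⟨ sum-map≡∑ _ sizes ⟩
    ∑ (λ t → sign t * sumℤ (map (N t) (subsetsOfSize S t))) sizes
      ≡⟨ ∑-cong (λ t → cong (sign t *_) (trans (sum-map≡∑ (N t) (subsetsOfSize S t)) (∑-filterᵇ (ofSize t) (N t) subsets))) sizes ⟩
    ∑ (λ t → sign t * ∑ (λ U → when (ofSize t U) (N t U)) subsets) sizes
      ≡⟨ ∑-cong (λ t → ∑-*ˡ (sign t) _ subsets) sizes ⟨
    ∑ (λ t → ∑ (λ U → sign t * when (ofSize t U) (N t U)) subsets) sizes
      ≡⟨ ∑-comm (λ t U → sign t * when (ofSize t U) (N t U)) sizes subsets ⟩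
    ∑ (λ U → ∑ (λ t → sign t * when (ofSize t U) (N t U)) sizes) subsets
      ≡⟨ ∑-cong (λ U → trans (∑-map _ suc (upTo i)) (∑-applyUpTo _ (λ t → t) i)) subsets ⟩
    ∑ (λ U → ∑< (λ t → -1ℤ ^ t * when (ofSize (suc t) U) (N (suc t) U)) i) subsets
      ≡⟨ ∑-cong (λ U → ∑<-select-size (does (U ⊆? S)) ∣ U ∣ i (λ t → N t U)) subsets ⟩
    ∑ (signedCount S i g) subsets ∎
    where
    sizes : List ℕ
    sizes = map suc (upTo i)
    subsets : List (Subset n)
    subsets = allSubsets n
    sign : ℕ → ℤ
    sign t = -1ℤ ^ (t ∸ 1)
    N : ℕ → Subset n → ℤ
    N t U = + M ⊤ (i ∸ t) (g ⊕ (⊖ subsetSum U))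
    ofSize : ℕ → Subset n → Bool
    ofSize t U = does (U ⊆? S) ∧ (∣ U ∣ ≡ᵇ t)

  M-∁≡M-⊤-M-S : ∀ S i g → + M (∁ S) i g ≡ + M ⊤ i g - + M-S S i g
  M-∁≡M-⊤-M-S S i g = begin
    + M (∁ S) i g
      ≡⟨ M-∁≡∑ S i g ⟩
    ∑ (λ m → when (not (intersects S (support m))) (sumsTo g m)) ms
      ≡⟨ ∑-cong (λ m → complement (intersects S (support m)) (sumsTo g m)) ms ⟩
    ∑ (λ m → sumsTo g m - when (intersects S (support m)) (sumsTo g m)) ms
      ≡⟨ ∑-difference (sumsTo g) _ ms ⟩
    ∑ (sumsTo g) ms - ∑ (λ m → when (intersects S (support m)) (sumsTo g m)) ms
      ≡⟨ cong₂ _-_ (M-⊤≡∑ i g) (M-S≡∑ S i g) ⟨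
    + M ⊤ i g - + M-S S i g ∎
    where
    ms : List (Vec ℕ n)
    ms = multisets n i
    complement : ∀ b x → when (not b) x ≡ x - when b x
    complement true  x = sym (ℤ.+-inverseʳ x)
    complement false x = sym (ℤ.+-identityʳ x)

proposition1 : (n : ℕ) (_⊕_ : Op₂ (Fin n)) (0# : Fin n) (⊖_ : Op₁ (Fin n)) →
    IsAbelianGroup _≡_ _⊕_ 0# ⊖_ →
    (S : Subset n) → Nonempty S → (g : Fin n) (i : ℕ) → 1 ≤ i →
    let open Counting _⊕_ 0# ⊖_ in
    (+ M-S S i g ≡ sumℤ (map (λ t → (-[1+ 0 ] ^ (t ∸ 1)) * sumℤ (map (λ U → + M ⊤ (i ∸ t) (g ⊕ (⊖ subsetSum U))) (subsetsOfSize S t))) (map suc (upTo i))))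
    × (+ M (∁ S) i g ≡ + M ⊤ i g - + M-S S i g)
proposition1 n _⊕_ 0# ⊖_ isAbelianGroup S _ g i _ =
  trans (M-S≡∑-signedCount S i g) (sym (∑-bySize≡∑-signedCount S i g)) , M-∁≡M-⊤-M-S S i g
  where open AbelianCounting _⊕_ 0# ⊖_ isAbelianGroup
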